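{- Let $g\ge 4$ be an even integer and let $m>g(g-1)$ be an odd integer not divisible by $g-1$. Let $G_{m,g}=\{g^j \bmod m : j=0,1,2,\dots\}\subseteq\mathbb{Z}_m$. If at least one of the residues $g+1,g+2,\dots,g(g-1)$ modulo $m$ belongs to $G_{m,g}$, then $m$ is complete (with respect to $g$).
   Context: Fix an even integer $g\ge4$. For an odd integer $m\ge1$, an extreme cycle for the digit set $\{0,m\}$ is a finite set of distinct integers $\{x_0,\dots,x_{r-1}\}$ together with digits $l_0,\dots,l_{r-1}\in\{0,m\}$ such that $x_{j+1}=(x_j+l_j)/g$ for $0\le j\le r-2$ and $x_0=(x_{r-1}+l_{r-1})/g$. The cycle $\{0\}$ (with digit $0$) is the trivial extreme cycle. The number $m$ is complete if the only extreme cycle for $\{0,m\}$ is the trivial one, and incomplete otherwise. -}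

module Defs where

open import Data.Nat as ℕ using (ℕ; suc)
open import Data.Integer as ℤ using (ℤ; +_)
open import Data.Fin using (Fin; zero; suc; inject₁; fromℕ)
open import Function.Definitions using (Injective)
open import Relation.Binary.PropositionalEquality using (_≡_)
open import Data.Sum using (_⊎_)
open import Data.Product using (_×_)

-- The cycle has r = suc n elements x₀ … x_{r-1} (pairwise distinct integers),
-- digits l_j ∈ {0, m}, with x_{j+1} = (x_j + l_j)/g (exact division, i.e.
-- g·x_{j+1} = x_j + l_j) for j ≤ r-2, and x₀ = (x_{r-1} + l_{r-1})/g.
record ExtremeCycle (g m : ℕ) : Set where
  field
    n      : ℕ
    x      : Fin (suc n) → ℤ
    l      : Fin (suc n) → ℤ
    distinct : Injective _≡_ _≡_ x
    digit  : ∀ j → l j ≡ + 0 ⊎ l j ≡ + m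
    step   : ∀ (j : Fin n) → x (inject₁ j) ℤ.+ l (inject₁ j) ≡ + g ℤ.* x (suc j)
    close  : x (fromℕ n) ℤ.+ l (fromℕ n) ≡ + g ℤ.* x zero

IsTrivial : ∀ {g m} → ExtremeCycle g m → Set
IsTrivial c = (ExtremeCycle.n c ≡ 0) × (ExtremeCycle.x c zero ≡ + 0) × (ExtremeCycle.l c zero ≡ + 0)

Complete : ℕ → ℕ → Set
Complete g m = (c : ExtremeCycle g m) → IsTrivial c

InG : (g m a : ℕ) → .{{_ : ℕ.NonZero m}} → Set
InG g m a = Data.Product.∃ λ j → (g ℕ.^ j) ℕ.% m ≡ a ℕ.% m
  where import Data.Product

module Submission where

open import Defs
open import Data.Nat using (ℕ; _+_; _*_; _∸_; _≤_; _<_; NonZero)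
open import Data.Nat.Divisibility using (_∣_)
open import Data.Product using (∃; _×_)
open import Relation.Nullary using (¬_)

open import Data.Nat using (zero; suc; z≤n; s≤s; _%_; _^_; _<?_; >-nonZero)
open import Data.Nat.Properties
open import Data.Nat.DivMod using (%-distribˡ-*; m%n%n≡m%n; m<n⇒m%n≡m; m≤n⇒[n∸m]%m≡n%m; [m+n]%n≡m%n)
open import Data.Nat.Divisibility using (divides)
open import Data.Nat.Induction using (<-wellFounded)
open import Data.Nat.Tactic.RingSolver using (solve-∀)
open import Induction.WellFounded using (Acc; acc)
open import Data.Integer as ℤ using (+_; -[1+_]; ∣_∣; -≤-)
import Data.Integer.Properties as ℤP
open import Data.Fin using (Fin; zero; suc; inject₁; fromℕ; toℕ)
open import Data.Fin.Properties using (any?; toℕ-fromℕ; toℕ-inject₁)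
open import Data.List using (allFin)
import Data.List.Relation.Unary.All as All
open import Data.List.Membership.Propositional.Properties using (∈-allFin)
open import Data.List.Extrema ℤP.≤-totalOrder using (argmin; argmax; f[argmin]≤f[xs]; f[xs]≤f[argmax])
open import Data.Product using (_,_; proj₁; proj₂)
open import Data.Sum as Sum using (_⊎_; inj₁; inj₂)
open import Data.Empty using (⊥; ⊥-elim)
open import Relation.Nullary using (yes; no)
open import Relation.Binary.PropositionalEquality

-- Write g = g₁ + 1 with g₁ = g − 1 ≥ 3.  Let x₀ … x_{r−1} be an extreme cycle.
-- (1) The minimum satisfies x_min ≤ x_prev + l_prev = g·x_min, so all xⱼ ≥ 0; the
--     maximum satisfies g·x_max ≤ x_max + m, so g₁·x_max ≤ m, strictly since g₁ ∤ m.
-- (2) Hence the set S of values is "digit closed": g₁·v < m for v ∈ S, and for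
--     v ∈ S either g·v ∈ S or g·v − m ∈ S.  Such a set is stable under
--     multiplication by g modulo m, hence by every k ≡ g^J (mod m).
-- (3) If 0 ∈ S, the predecessor of 0 is 0 itself with digit 0, so by distinctness
--     the cycle is trivial.
-- (4) Otherwise S is positive.  Descending along v ↦ g·v − m we find w ∈ S with
--     g·w ∈ S; ascending along w ↦ k·w (which stays below m) we reach a "peak" v with
--     v, g·v ∈ S but g·k·v ≥ m.  Comparing sizes at a peak is contradictory both
--     for k ≥ g + 2 and (via the element g·k·v − m + k·v ∈ S) for k = g + 1.
-- The theorem combines (1)–(4).

-- (g−1)(g+2) > g² as soon as g ≥ 3; this rules out multipliers k ≥ g + 2.
square<shifted : ∀ g₁ → 2 ≤ g₁ → suc g₁ * suc g₁ < g₁ * suc (suc g₁ + 1)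
square<shifted _ (s≤s (s≤s {n = t} z≤n)) = ≤-trans (m≤m+n _ t) (≤-reflexive (expand t))
  where
  expand : ∀ t → suc ((3 + t) * (3 + t)) + t ≡ (2 + t) * suc ((3 + t) + 1)
  expand = solve-∀

sum-below : ∀ c {a b x} → 2 ≤ c → c * a < x → c * b < x → a + b < x
sum-below c {a} {b} {x} 2≤c ca<x cb<x = *-cancelˡ-< 2 (a + b) x (begin-strict
  2 * (a + b)    ≤⟨ *-monoˡ-≤ (a + b) 2≤c ⟩
  c * (a + b)    ≡⟨ *-distribˡ-+ c a b ⟩
  c * a + c * b  <⟨ +-mono-< ca<x cb<x ⟩
  x + x          ≡⟨ cong (_+_ x) (+-identityʳ x) ⟨
  2 * x          ∎)
  where open ≤-Reasoning

succ-below-double : ∀ c {a x} .{{_ : NonZero c}} → c * a < x → suc c * a < x + x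
succ-below-double c {a} ca<x = +-mono-≤-< (≤-trans (m≤n*m a c) (<⇒≤ ca<x)) ca<x

nonneg-of-≤-multiple : ∀ c .{{_ : NonZero c}} x → x ℤ.≤ + suc c ℤ.* x → ℤ.0ℤ ℤ.≤ x
nonneg-of-≤-multiple c       (+ v)      _       = ℤ.+≤+ z≤n
nonneg-of-≤-multiple (suc c) -[1+ t ] (-≤- le) = ⊥-elim (m+1+n≰m t le)

module DigitClosedSets (g₁ m : ℕ) .{{_ : NonZero g₁}} .{{_ : NonZero m}} where

  g : ℕ
  g = suc g₁

  record DigitClosed (S : ℕ → Set) : Set where
    field
      bounded   : ∀ {v} → S v → g₁ * v < m
      digitStep : ∀ {v} → S v → S (g * v) ⊎ (m ≤ g * v × S (g * v ∸ m))

  Stable : (ℕ → Set) → ℕ → Set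
  Stable S a = ∀ {v} → S v → S ((a * v) % m)

  *-%-cong : ∀ {a b c d} → a % m ≡ b % m → c % m ≡ d % m → (a * c) % m ≡ (b * d) % m
  *-%-cong {a} {b} {c} {d} a≡b c≡d = begin
    (a * c) % m              ≡⟨ %-distribˡ-* a c m ⟩
    ((a % m) * (c % m)) % m  ≡⟨ cong₂ (λ s t → (s * t) % m) a≡b c≡d ⟩
    ((b % m) * (d % m)) % m  ≡⟨ %-distribˡ-* b d m ⟨
    (b * d) % m              ∎
    where open ≡-Reasoning

  module _ {S : ℕ → Set} (closed : DigitClosed S) where
    open DigitClosed closed

    below-m : ∀ {v} → S v → v < m
    below-m {v} sv = ≤-<-trans (m≤n*m v g₁) (bounded sv)

    step-small : ∀ {v} → S v → g * v < m → S (g * v)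
    step-small sv gv<m with digitStep sv
    ... | inj₁ sgv         = sgv
    ... | inj₂ (m≤gv , _)  = ⊥-elim (<⇒≱ gv<m m≤gv)

    step-large : ∀ {v} → S v → m ≤ g * v → S (g * v ∸ m)
    step-large sv m≤gv with digitStep sv
    ... | inj₁ sgv    = ⊥-elim (<⇒≱ (below-m sgv) m≤gv)
    ... | inj₂ (_ , s) = s

    stable-g : Stable S g
    stable-g {v} sv with g * v <? m
    ... | yes gv<m = subst S (sym (m<n⇒m%n≡m gv<m)) (step-small sv gv<m)
    ... | no  gv≮m = subst S (trans (sym (m<n⇒m%n≡m (below-m s))) (m≤n⇒[n∸m]%m≡n%m m≤gv)) s
      where
      m≤gv : m ≤ g * v
      m≤gv = ≮⇒≥ gv≮m
      s : S (g * v ∸ m)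
      s = step-large sv m≤gv

    stable-* : ∀ {a b} → Stable S a → Stable S b → Stable S (a * b)
    stable-* {a} {b} sa sb {v} sv = subst S residue (sa (sb sv))
      where
      residue : (a * ((b * v) % m)) % m ≡ (a * b * v) % m
      residue = trans (*-%-cong {a} {a} refl (m%n%n≡m%n (b * v) m)) (cong (_% m) (sym (*-assoc a b v)))

    stable-^ : ∀ i → Stable S (g ^ i)
    stable-^ zero    {v} sv = subst S (sym (trans (cong (_% m) (*-identityˡ v)) (m<n⇒m%n≡m (below-m sv)))) sv
    stable-^ (suc i)        = stable-* {g} {g ^ i} stable-g (stable-^ i)

    stable-mod : ∀ {a b} → a % m ≡ b % m → Stable S a → Stable S b
    stable-mod a≡b sa sv = subst S (*-%-cong a≡b refl) (sa sv)

module NoPositiveStableSet (g₁ m k : ℕ) .{{_ : NonZero g₁}} .{{_ : NonZero m}}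
  (2≤g₁ : 2 ≤ g₁) (k-lo : suc g₁ + 1 ≤ k) (k-hi : k ≤ suc g₁ * g₁)
  {S : ℕ → Set} (closed : DigitClosedSets.DigitClosed g₁ m S)
  (stable-k : DigitClosedSets.Stable g₁ m S k) (positive : ∀ {v} → S v → 0 < v) where

  open DigitClosedSets g₁ m
  open DigitClosed closed

  k-below : ∀ {w} → S (g * w) → k * w < m
  k-below {w} sgw = begin-strict
    k * w         ≤⟨ *-monoˡ-≤ w k-hi ⟩
    g * g₁ * w    ≡⟨ rearrange g g₁ w ⟩
    g₁ * (g * w)  <⟨ bounded sgw ⟩
    m             ∎
    where
    open ≤-Reasoning
    rearrange : ∀ a b c → a * b * c ≡ b * (a * c)
    rearrange = solve-∀

  k-step : ∀ {w} → S w → S (g * w) → S (k * w)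
  k-step sw sgw = subst S (m<n⇒m%n≡m (k-below sgw)) (stable-k sw)

  -- Replacing v by g·v − m strictly decreases v, so eventually g·v ∈ S.
  descend : ∀ {v} → Acc _<_ v → S v → ∃ λ w → S w × S (g * w)
  descend {v} (acc smaller) sv with g * v <? m
  ... | yes gv<m = v , sv , step-small closed sv gv<m
  ... | no  gv≮m = descend (smaller decrease) (step-large closed sv (≮⇒≥ gv≮m))
    where
    decrease : g * v ∸ m < v
    decrease = m<n+o⇒m∸n<o (g * v) m {{>-nonZero (positive sv)}}
                 (<-≤-trans (+-monoʳ-< v (bounded sv)) (≤-reflexive (+-comm v m)))

  -- A point where the k-orbit is about to leave the range in which g·v stays below m.
  Peak : ℕ → Set
  Peak v = S v × S (g * v) × m ≤ g * (k * v)

  -- Along w, k·w, k²·w, … the elements increase and stay below m, so a peak is reached.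
  ascend : ∀ {w} → Acc _<_ (m ∸ w) → S w → S (g * w) → ∃ Peak
  ascend {w} (acc smaller) sw sgw with g * (k * w) <? m
  ... | no  gkw≮m = w , sw , sgw , ≮⇒≥ gkw≮m
  ... | yes gkw<m = ascend (smaller (∸-monoʳ-< w<kw (<⇒≤ (k-below sgw)))) skw (step-small closed skw gkw<m)
    where
    skw : S (k * w)
    skw = k-step sw sgw
    w<kw : w < k * w
    w<kw = <-≤-trans (m<m*n w k {{>-nonZero (positive sw)}} (≤-trans (s≤s (m≤n+m 1 g₁)) k-lo))
                     (≤-reflexive (*-comm w k))

  -- At a peak also g²·v overflows, since g·k·v ≤ g₁·(g·(g·v)).
  overflow-gg : ∀ {v} → S (g * v) → m ≤ g * (k * v) → m ≤ g * (g * v)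
  overflow-gg {v} sgv m≤gkv = ≮⇒≥ λ ggv<m → <⇒≱ (begin-strict
    g * (k * v)         ≤⟨ *-monoʳ-≤ g (*-monoˡ-≤ v k-hi) ⟩
    g * (g * g₁ * v)    ≡⟨ rearrange g g₁ v ⟩
    g₁ * (g * (g * v))  <⟨ bounded (step-small closed sgv ggv<m) ⟩
    m                   ∎) m≤gkv
    where
    open ≤-Reasoning
    rearrange : ∀ a b c → a * (a * b * c) ≡ b * (a * (a * c))
    rearrange = solve-∀

  large-k : ∀ {v} → S (k * v) → m ≤ g * (g * v) → g + 1 < k → ⊥
  large-k {v} skv m≤ggv g+1<k = <⇒≱ g²<g₁k (<⇒≤ (*-cancelʳ-< m (g₁ * k) (g * g) (begin-strict
    g₁ * k * m              ≤⟨ *-monoʳ-≤ (g₁ * k) m≤ggv ⟩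
    g₁ * k * (g * (g * v))  ≡⟨ rearrange g₁ k g v ⟩
    g * g * (g₁ * (k * v))  <⟨ *-monoʳ-< (g * g) (bounded skv) ⟩
    g * g * m               ∎)))
    where
    open ≤-Reasoning
    rearrange : ∀ a b c d → a * b * (c * (c * d)) ≡ c * c * (a * (b * d))
    rearrange = solve-∀
    g²<g₁k : g * g < g₁ * k
    g²<g₁k = <-≤-trans (square<shifted g₁ 2≤g₁) (*-monoʳ-≤ g₁ g+1<k)

  -- For k = g + 1, put u = k·v and q = g·u − m ∈ S.  Then k·u = (q + u) + m with
  -- q + u < m, so q + u ∈ S; but g·(q + u) ≥ 2m contradicts g₁·(q + u) < m.
  k-is-g+1 : ∀ {v} → k ≡ g + 1 → S (k * v) → m ≤ g * (k * v) → m ≤ g * (g * v) → ⊥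
  k-is-g+1 {v} k≡g+1 skv m≤gu m≤ggv = <⇒≱ (succ-below-double g₁ (bounded squ)) 2m≤g[q+u]
    where
    u q : ℕ
    u = k * v
    q = g * u ∸ m
    sq : S q
    sq = step-large closed skv m≤gu
    gu≡ : g * u ≡ g * v + g * (g * v)
    gu≡ = trans (cong (λ c → g * (c * v)) k≡g+1) (expand g v)
      where
      expand : ∀ a b → a * ((a + 1) * b) ≡ a * b + a * (a * b)
      expand = solve-∀
    gv≤q : g * v ≤ q
    gv≤q = m+n≤o⇒m≤o∸n (g * v) (≤-trans (+-monoʳ-≤ (g * v) m≤ggv) (≤-reflexive (sym gu≡)))
    ku≡ : k * u ≡ (q + u) + m
    ku≡ = begin
      k * u        ≡⟨ cong (_* u) k≡g+1 ⟩
      (g + 1) * u  ≡⟨ expand g u ⟩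
      g * u + u    ≡⟨ cong (_+ u) (m∸n+n≡m m≤gu) ⟨
      q + m + u    ≡⟨ swap q m u ⟩
      q + u + m    ∎
      where
      open ≡-Reasoning
      expand : ∀ a b → (a + 1) * b ≡ a * b + b
      expand = solve-∀
      swap : ∀ a b c → a + b + c ≡ a + c + b
      swap = solve-∀
    q+u<m : q + u < m
    q+u<m = sum-below g₁ 2≤g₁ (bounded sq) (bounded skv)
    squ : S (q + u)
    squ = subst S (trans (cong (_% m) ku≡) (trans ([m+n]%n≡m%n (q + u) m) (m<n⇒m%n≡m q+u<m))) (stable-k skv)
    2m≤g[q+u] : m + m ≤ g * (q + u)
    2m≤g[q+u] = subst (m + m ≤_) (sym (*-distribˡ-+ g q u))
                  (+-mono-≤ (≤-trans m≤ggv (*-monoʳ-≤ g gv≤q)) m≤gu)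

  no-peak : ∀ {v} → Peak v → ⊥
  no-peak (sv , sgv , m≤gkv) with k ≟ g + 1
  ... | yes k≡g+1 = k-is-g+1 k≡g+1 (k-step sv sgv) m≤gkv (overflow-gg sgv m≤gkv)
  ... | no  k≢g+1 = large-k (k-step sv sgv) (overflow-gg sgv m≤gkv) (≤∧≢⇒< k-lo (λ e → k≢g+1 (sym e)))

  empty : ∀ {v} → S v → ⊥
  empty sv =
    let w , sw , sgw = descend (<-wellFounded _) sv
        _ , peak     = ascend (<-wellFounded (m ∸ w)) sw sgw
    in no-peak peak

module CycleValues {g₁ m : ℕ} .{{_ : NonZero g₁}} .{{_ : NonZero m}} (cy : ExtremeCycle (suc g₁) m) where

  open ExtremeCycle cy
  open DigitClosedSets g₁ m using (g; DigitClosed)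

  prev : Fin (suc n) → Fin (suc n)
  prev zero    = fromℕ n
  prev (suc i) = inject₁ i

  prev-step : ∀ j → x (prev j) ℤ.+ l (prev j) ≡ + g ℤ.* x j
  prev-step zero    = close
  prev-step (suc i) = step i

  prev-fixed : ∀ j → prev j ≡ j → n ≡ 0 × j ≡ zero
  prev-fixed zero    eq = trans (sym (toℕ-fromℕ n)) (cong toℕ eq) , refl
  prev-fixed (suc i) eq = ⊥-elim (<-irrefl (trans (sym (toℕ-inject₁ i)) (cong toℕ eq)) (n<1+n (toℕ i)))

  d : Fin (suc n) → ℕ
  d j = ∣ l j ∣

  l≡d : ∀ j → l j ≡ + d j
  l≡d j with digit j
  ... | inj₁ e rewrite e = refl
  ... | inj₂ e rewrite e = refl

  d≤m : ∀ j → d j ≤ m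
  d≤m j with Sum.map (cong ∣_∣) (cong ∣_∣) (digit j)
  ... | inj₁ d≡0 = subst (_≤ m) (sym d≡0) z≤n
  ... | inj₂ d≡m = ≤-reflexive d≡m

  jmin jmax : Fin (suc n)
  jmin = argmin x zero (allFin _)
  jmax = argmax x zero (allFin _)

  x-min : ∀ j → x jmin ℤ.≤ x j
  x-min j = All.lookup (f[argmin]≤f[xs] {f = x} zero (allFin _)) (∈-allFin j)

  x-max : ∀ j → x j ℤ.≤ x jmax
  x-max j = All.lookup (f[xs]≤f[argmax] {f = x} zero (allFin _)) (∈-allFin j)

  x-min-nonneg : ℤ.0ℤ ℤ.≤ x jmin
  x-min-nonneg = nonneg-of-≤-multiple g₁ (x jmin) (begin
    x jmin                              ≤⟨ x-min (prev jmin) ⟩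
    x (prev jmin)                       ≤⟨ ℤP.i≤i+j _ (+ d (prev jmin)) ⟩
    x (prev jmin) ℤ.+ + d (prev jmin)   ≡⟨ cong (ℤ._+_ (x (prev jmin))) (l≡d (prev jmin)) ⟨
    x (prev jmin) ℤ.+ l (prev jmin)     ≡⟨ prev-step jmin ⟩
    + g ℤ.* x jmin                      ∎)
    where open ℤP.≤-Reasoning

  val : Fin (suc n) → ℕ
  val j = ∣ x j ∣

  x≡val : ∀ j → x j ≡ + val j
  x≡val j = sym (ℤP.0≤i⇒+∣i∣≡i (ℤP.≤-trans x-min-nonneg (x-min j)))

  val-step : ∀ j → val (prev j) + d (prev j) ≡ g * val j
  val-step j = ℤP.+-injective (begin
    + (val (prev j) + d (prev j))    ≡⟨ ℤP.pos-+ (val (prev j)) (d (prev j)) ⟩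
    + val (prev j) ℤ.+ + d (prev j)  ≡⟨ cong₂ ℤ._+_ (x≡val (prev j)) (l≡d (prev j)) ⟨
    x (prev j) ℤ.+ l (prev j)        ≡⟨ prev-step j ⟩
    + g ℤ.* x j                      ≡⟨ cong (ℤ._*_ (+ g)) (x≡val j) ⟩
    + g ℤ.* + val j                  ≡⟨ ℤP.pos-* g (val j) ⟨
    + (g * val j)                    ∎)
    where open ≡-Reasoning

  val-max : ∀ j → val j ≤ val jmax
  val-max j = ℤP.drop‿+≤+ (subst₂ ℤ._≤_ (x≡val j) (x≡val jmax) (x-max j))

  -- g·x_max = x_prev + l_prev ≤ x_max + m, and equality g₁·x_max = m would give g₁ ∣ m.
  max-bound : ¬ (g₁ ∣ m) → g₁ * val jmax < m
  max-bound g₁∤m = ≤∧≢⇒< (+-cancelˡ-≤ (val jmax) _ _ (begin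
      val jmax + g₁ * val jmax         ≡⟨ val-step jmax ⟨
      val (prev jmax) + d (prev jmax)  ≤⟨ +-mono-≤ (val-max (prev jmax)) (d≤m (prev jmax)) ⟩
      val jmax + m                     ∎))
    (λ eq → g₁∤m (divides (val jmax) (trans (sym eq) (*-comm g₁ (val jmax)))))
    where open ≤-Reasoning

  Values : ℕ → Set
  Values v = ∃ λ j → val j ≡ v

  values-closed : ¬ (g₁ ∣ m) → DigitClosed Values
  values-closed g₁∤m = record { bounded = bounded ; digitStep = digitStep }
    where
    bounded : ∀ {v} → Values v → g₁ * v < m
    bounded (j , refl) = ≤-<-trans (*-monoʳ-≤ g₁ (val-max j)) (max-bound g₁∤m)
    digitStep : ∀ {v} → Values v → Values (g * v) ⊎ (m ≤ g * v × Values (g * v ∸ m))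
    digitStep (j , refl) with Sum.map (cong ∣_∣) (cong ∣_∣) (digit (prev j))
    ... | inj₁ d≡0 = inj₁ (prev j , trans (sym (+-identityʳ _)) (subst (λ e → val (prev j) + e ≡ g * val j) d≡0 (val-step j)))
    ... | inj₂ d≡m = inj₂ (subst (m ≤_) eq (m≤n+m m _) , prev j , trans (sym (m+n∸n≡m _ m)) (cong (_∸ m) eq))
      where
      eq : val (prev j) + m ≡ g * val j
      eq = subst (λ e → val (prev j) + e ≡ g * val j) d≡m (val-step j)

  -- If some element is 0, its predecessor is 0 with digit 0 (as g·0 = 0), so by
  -- distinctness it is its own predecessor and the cycle is trivial.
  trivial-if-zero : ∀ j → val j ≡ 0 → IsTrivial cy
  trivial-if-zero j val≡0 = n≡0 , subst (λ i → x i ≡ + 0) j≡zero xj≡0 , subst (λ i → l i ≡ + 0) j≡zero lj≡0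
    where
    sum≡0 : val (prev j) + d (prev j) ≡ 0
    sum≡0 = trans (val-step j) (trans (cong (g *_) val≡0) (*-zeroʳ g))
    xj≡0 : x j ≡ + 0
    xj≡0 = trans (x≡val j) (cong +_ val≡0)
    prev≡j : prev j ≡ j
    prev≡j = distinct (trans (x≡val (prev j)) (trans (cong +_ (m+n≡0⇒m≡0 _ sum≡0)) (sym xj≡0)))
    lj≡0 : l j ≡ + 0
    lj≡0 = subst (λ i → l i ≡ + 0) prev≡j (trans (l≡d (prev j)) (cong +_ (m+n≡0⇒n≡0 _ sum≡0)))
    n≡0 : n ≡ 0
    n≡0 = proj₁ (prev-fixed j prev≡j)
    j≡zero : j ≡ zero
    j≡zero = proj₂ (prev-fixed j prev≡j)

theorem2p13 : (g m : ℕ) → .{{_ : NonZero m}} → 4 ≤ g → 2 ∣ g → ¬ (2 ∣ m) → g * (g ∸ 1) < m → ¬ ((g ∸ 1) ∣ m) →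
    (∃ λ k → g + 1 ≤ k × k ≤ g * (g ∸ 1) × InG g m k) → Complete g m
theorem2p13 g m (s≤s (s≤s (s≤s (s≤s {n = h} _)))) _ _ _ g₁∤m (k , k-lo , k-hi , J , g^J≡k) cy
  with any? (λ j → CycleValues.val cy j ≟ 0)
... | yes (j , val≡0) = CycleValues.trivial-if-zero cy j val≡0
... | no  no-zero     =
  ⊥-elim (NoPositiveStableSet.empty (3 + h) m k (s≤s (s≤s z≤n)) k-lo k-hi closed stable-k positive (zero , refl))
  where
  open CycleValues cy
  open DigitClosedSets (3 + h) m
  closed : DigitClosed Values
  closed = values-closed g₁∤m
  stable-k : Stable Values k
  stable-k = stable-mod closed g^J≡k (stable-^ closed J)
  positive : ∀ {v} → Values v → 0 < v
  positive (j , refl) = n≢0⇒n>0 (λ val≡0 → no-zero (j , val≡0))
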